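{- Let $\eta:A^*\to A^*$ be a substitution and $u\in A^{\mathbb{Z}}$ a two-sided periodic point of $\eta$ with growing seed $s=u_{ -1}|u_0$, and let $p\ge1$ be the period of $u$. Then \[ \mathrm{rep}_u(\mathbb{Z})=\bigcup_{\ell\in\mathbb{N}}\mathcal{L}_{\ell p+1}(\mathcal{A}_{\eta,s})\setminus\{0\,\mathtt{W}_{\min},\,1\,\mathtt{W}_{\max}\}\mathcal{D}^*. \]
   Context: $A$ is a finite alphabet, $A^*$ the finite words, $\varepsilon$ the empty word, $|w|$ the length, $w[i]$ the $i$-th letter (from $0$). A substitution is a morphism $\eta:A^*\to A^*$ with $\eta(a)\neq\varepsilon$ for all $a$ and some letter growing ($|\eta^k(a)|\to\infty$). $\eta$ acts on $u\in A^{\mathbb{Z}}$ by $\eta(\cdots u_{ -1}|u_0\cdots)=\cdots\eta(u_{ -2})\eta(u_{ -1})|\eta(u_0)\eta(u_1)\cdots$ ($|$ separating positions $-1$ and $0$); $u$ is a periodic point if $\eta^p(u)=u$ for some $p\ge1$, its period is the least such $p$; the seed $u_{ -1}|u_0$ is growing if both letters are growing. A sequence $(m_i,a_i)_{i=0,\dots,k}$ in $A^*\times A$ is $x$-admissible if $m_{i-1}a_{i-1}$ is a prefix of $\eta(a_i)$ for $1\le i\le k$ and $m_ka_k$ is a prefix of $\eta(x)$. Let $\mathcal{D}=\{0,\dots,\max_c|\eta(c)|-1\}$; $\odot$ (or juxtaposition) is concatenation of words over $\mathcal{D}$. For $q\ge1$, $x\in A$, $0\le n<|\eta^q(x)|$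 there is a unique $x$-admissible $(m_i,a_i)_{i=0,\dots,q-1}$ with $n=\sum_j|\eta^j(m_j)|$, and $\mathrm{tail}_{\eta,q,x}(n)=|m_{q-1}|\odot\cdots\odot|m_0|$. Set $\mathtt{W}_{\min}=0^p$ and $\mathtt{W}_{\max}=\mathrm{tail}_{\eta,p,u_{ -1}}(|\eta^p(u_{ -1})|-1)$. Numeration system: for $n\ge1$ there are a unique $k$ divisible by $p$ and a unique $u_0$-admissible $(m_i,a_i)_{i=0,\dots,k-1}$ with $m_{k-1}\cdots m_{k-p}\ne\varepsilon$ and $u_0\cdots u_{n-1}=\eta^{k-1}(m_{k-1})\cdots\eta^0(m_0)$; for $n\le-2$ there are a unique $k$ divisible by $p$ and a unique $u_{ -1}$-admissible $(m_i,a_i)_{i=0,\dots,k-1}$ with $\eta^{p-1}(m_{k-1})\cdots\eta^0(m_{k-p})a_{k-p}\ne\eta^p(u_{ -1})$ and $u_{ -|\eta^k(u_{ -1})|}\cdots u_{n-1}=\eta^{k-1}(m_{k-1})\cdots\eta^0(m_0)$. Then $\mathrm{rep}_u(n)=0\odot|m_{k-1}|\odot\cdots\odot|m_0|$ ($n\ge1$), $\mathrm{rep}_u(0)=0$, $\mathrm{rep}_u(-1)=1$, $\mathrm{rep}_u(n)=1\odot|m_{k-1}|\odot\cdots\odot|m_0|$ ($n\le-2$). The automaton $\mathcal{A}_{\eta,s}$ has states $A\cup\{\mathtt{start}\}$, initial state $\mathtt{start}$, accepting states $A$, partial transitions $\delta(\mathtt{start},0)=u_0$, $\delta(\mathtt{start},1)=u_{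 -1}$, $\delta(c,i)=\eta(c)[i]$ for $c\in A$, $0\le i<|\eta(c)|$, extended to words; $\mathcal{L}(\mathcal{A}_{\eta,s})$ is the set of $w\in\mathcal{D}^*$ with $\delta(\mathtt{start},w)$ defined and in $A$, and $\mathcal{L}_q(\mathcal{A}_{\eta,s})$ its words of length $q$. -}

module Defs where

open import Data.Nat using (ℕ; zero; suc; _+_; _*_; _∸_; _≤_; _<_; _⊔_; _<?_)
open import Data.Integer using (ℤ; +_; -[1+_]) renaming (_+_ to _+ℤ_; _-_ to _-ℤ_; -_ to -ℤ_)
open import Data.Fin using (Fin)
open import Data.List using (List; []; _∷_; _++_; length; concatMap; foldr; map; replicate)
open import Data.List.NonEmpty using (List⁺; toList)
open import Data.List.Relation.Unary.All using (All)
open import Data.Maybe using (Maybe; just; nothing)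
open import Data.Product using (Σ; ∃; _×_; _,_)
open import Relation.Binary.PropositionalEquality using (_≡_; _≢_)
open import Relation.Nullary using (¬_; yes; no)
open import Function.Bundles using (_⇔_)

Subst : ℕ → Set
Subst k = Fin k → List⁺ (Fin k)

img : ∀ {k} → Subst k → Fin k → List (Fin k)
img η c = toList (η c)

applyW : ∀ {k} → Subst k → List (Fin k) → List (Fin k)
applyW η w = concatMap (img η) w

iterW : ∀ {k} → Subst k → ℕ → List (Fin k) → List (Fin k)
iterW η zero    w = w
iterW η (suc j) w = applyW η (iterW η j w)

Growing : ∀ {k} → Subst k → Fin k → Set
Growing η a = ∀ (N : ℕ) → ∃ λ j → N ≤ length (iterW η j (a ∷ []))

IsSubstitution : ∀ {k} → Subst k → Set
IsSubstitution η = ∃ λ a → Growing η a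

nthD : ∀ {X : Set} → X → List X → ℕ → X
nthD d []       _       = d
nthD d (x ∷ xs) zero    = x
nthD d (x ∷ xs) (suc i) = nthD d xs i

nth? : ∀ {X : Set} → List X → ℕ → Maybe X
nth? []       _       = nothing
nth? (x ∷ xs) zero    = just x
nth? (x ∷ xs) (suc i) = nth? xs i

_⊑_ : ∀ {X : Set} → List X → List X → Set
xs ⊑ ys = ∃ λ t → xs ++ t ≡ ys

-- Action of η on two-sided sequences u : ℤ → A
--   η(... u₋₁ | u₀ ...) = ... η(u₋₂) η(u₋₁) | η(u₀) η(u₁) ...

module _ {k : ℕ} (η : Subst k) (u : ℤ → Fin k) where

  private
    lenAt : ℤ → ℕ
    lenAt j = length (img η (u j))

    letterAt : ℤ → ℕ → Fin k
    letterAt j i = nthD (Data.List.NonEmpty.head (η (u j))) (img η (u j)) i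

  -- walk forward n positions starting at letter i of block η(u_j)
  fwd : ℤ → ℕ → ℕ → Fin k
  fwd j i zero    = letterAt j i
  fwd j i (suc n) with suc i <? lenAt j
  ... | yes _ = fwd j (suc i) n
  ... | no  _ = fwd (j +ℤ + 1) 0 n

  -- walk backward n positions starting at letter i of block η(u_j)
  bwd : ℤ → ℕ → ℕ → Fin k
  bwd j i       zero    = letterAt j i
  bwd j (suc i) (suc n) = bwd j i n
  bwd j zero    (suc n) = bwd (j -ℤ + 1) (lenAt (j -ℤ + 1) ∸ 1) n

  act : ℤ → Fin k
  act (+ n)      = fwd (+ 0) 0 n
  act -[1+ n ]   = bwd (-[1+ 0 ]) (lenAt (-[1+ 0 ]) ∸ 1) n

actIter : ∀ {k} → Subst k → ℕ → (ℤ → Fin k) → (ℤ → Fin k)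
actIter η zero    u = u
actIter η (suc q) u = act η (actIter η q u)

FixedBy : ∀ {k} → Subst k → ℕ → (ℤ → Fin k) → Set
FixedBy η q u = ∀ z → actIter η q u z ≡ u z

IsPeriodicPointWithPeriod : ∀ {k} → Subst k → (ℤ → Fin k) → ℕ → Set
IsPeriodicPointWithPeriod η u p =
  1 ≤ p × FixedBy η p u × (∀ q → 1 ≤ q → q < p → ¬ FixedBy η q u)

GrowingSeed : ∀ {k} → Subst k → (ℤ → Fin k) → Set
GrowingSeed η u = Growing η (u -[1+ 0 ]) × Growing η (u (+ 0))

-- Admissible sequences (m_i, a_i)_{i=0..q-1}, given as functions ℕ → _
-- (only indices < q matter).

Admissible : ∀ {k} → Subst k → Fin k → (q : ℕ) → (ℕ → List (Fin k)) → (ℕ → Fin k) → Set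
Admissible η x zero    m a = Data.Unit.⊤ where import Data.Unit
Admissible η x (suc q) m a =
  (∀ i → i < q → (m i ++ a i ∷ []) ⊑ img η (a (suc i))) ×
  ((m q ++ a q ∷ []) ⊑ img η x)

-- η^{lo+len-1}(m_{lo+len-1}) ⋯ η^{lo}(m_{lo})  ... shifted so that the
-- exponent of m_j is (j - lo):  η^{len-1}(m_{lo+len-1}) ⋯ η^0(m_lo)
expandFrom : ∀ {k} → Subst k → (ℕ → List (Fin k)) → ℕ → ℕ → List (Fin k)
expandFrom η m lo zero      = []
expandFrom η m lo (suc len) = iterW η len (m (lo + len)) ++ expandFrom η m lo len

expand : ∀ {k} → Subst k → (ℕ → List (Fin k)) → ℕ → List (Fin k)
expand η m q = expandFrom η m 0 q

segment : ∀ {X : Set} → (ℕ → List X) → ℕ → ℕ → List X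
segment m lo zero      = []
segment m lo (suc len) = m (lo + len) ++ segment m lo len

digits : ∀ {X : Set} → (ℕ → List X) → ℕ → List ℕ
digits m zero    = []
digits m (suc q) = length (m q) ∷ digits m q

SliceEq : ∀ {k} → (ℤ → Fin k) → ℤ → ℤ → List (Fin k) → Set
SliceEq u start end w =
  (start +ℤ + length w ≡ end) ×
  (∀ i → i < length w → just (u (start +ℤ + i)) ≡ nth? w i)

-- tail_{η,q,x}(n) = W, relationally (the paper proves uniqueness)

TailRel : ∀ {k} → Subst k → ℕ → Fin k → ℕ → List ℕ → Set
TailRel {k} η q x n W =
  Σ (ℕ → List (Fin k)) λ m → Σ (ℕ → Fin k) λ a →
    Admissible η x q m a × n ≡ length (expand η m q) × W ≡ digits m q

IsWmax : ∀ {k} → Subst k → (ℤ → Fin k) → ℕ → List ℕ → Set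
IsWmax η u p W =
  TailRel η p (u -[1+ 0 ]) (length (iterW η p (u -[1+ 0 ] ∷ [])) ∸ 1) W

Wmin : ℕ → List ℕ
Wmin p = replicate p 0

-- rep_u(n) = w, relationally (the paper proves existence and uniqueness of
-- k and the admissible sequence).  k ranges over positive multiples
-- k = (t+1)·p of p.

RepRel : ∀ {k} → Subst k → (ℤ → Fin k) → ℕ → ℤ → List ℕ → Set
RepRel η u p (+ zero)          w = w ≡ 0 ∷ []
RepRel η u p -[1+ zero ]       w = w ≡ 1 ∷ []
RepRel {k} η u p (+ suc r)     w =
  ∃ λ (t : ℕ) → Σ (ℕ → List (Fin k)) λ m → Σ (ℕ → Fin k) λ a →
    Admissible η (u (+ 0)) (suc t * p) m a ×
    segment m (t * p) p ≢ [] ×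
    SliceEq u (+ 0) (+ suc r) (expand η m (suc t * p)) ×
    w ≡ 0 ∷ digits m (suc t * p)
RepRel {k} η u p -[1+ suc r ]  w =
  ∃ λ (t : ℕ) → Σ (ℕ → List (Fin k)) λ m → Σ (ℕ → Fin k) λ a →
    Admissible η (u -[1+ 0 ]) (suc t * p) m a ×
    (expandFrom η m (t * p) p ++ a (t * p) ∷ []) ≢ iterW η p (u -[1+ 0 ] ∷ []) ×
    SliceEq u (-ℤ (+ length (iterW η (suc t * p) (u -[1+ 0 ] ∷ []))))
              -[1+ suc r ] (expand η m (suc t * p)) ×
    w ≡ 1 ∷ digits m (suc t * p)

InRepImage : ∀ {k} → Subst k → (ℤ → Fin k) → ℕ → List ℕ → Set
InRepImage η u p w = ∃ λ n → RepRel η u p n w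

-- 𝒟 = {0, …, max_c |η(c)| - 1}
maxLen : ∀ {k} → Subst k → ℕ
maxLen {k} η = foldr _⊔_ 0 (map (λ c → length (img η c)) (Data.List.allFin k))
  where import Data.List

data State (k : ℕ) : Set where
  start  : State k
  letter : Fin k → State k

δ : ∀ {k} → Subst k → (ℤ → Fin k) → State k → ℕ → Maybe (State k)
δ η u start zero                = just (letter (u (+ 0)))
δ η u start (suc zero)          = just (letter (u -[1+ 0 ]))
δ η u start (suc (suc _))       = nothing
δ η u (letter c) i with nth? (img η c) i
... | just d  = just (letter d)
... | nothing = nothing

δ* : ∀ {k} → Subst k → (ℤ → Fin k) → State k → List ℕ → Maybe (State k)
δ* η u s []      = just s
δ* η u s (i ∷ w) with δ η u s i
... | just s' = δ* η u s' w
... | nothing = nothing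

Accepted : ∀ {k} → Subst k → (ℤ → Fin k) → List ℕ → Set
Accepted η u w = All (λ i → i < maxLen η) w × ∃ λ c → δ* η u start w ≡ just (letter c)

InRHS : ∀ {k} → Subst k → (ℤ → Fin k) → ℕ → List ℕ → Set
InRHS η u p w =
  (∃ λ ℓ → length w ≡ ℓ * p + 1) ×
  Accepted η u w ×
  ¬ ((0 ∷ Wmin p) ⊑ w) ×
  ¬ (∃ λ W → IsWmax η u p W × (1 ∷ W) ⊑ w)

module Submission where

-- An x-admissible sequence (m_i, a_i)_{i<q} is the same as a path of the automaton from state x
-- labelled |m_{q-1}| ⋯ |m_0| (digit d moves from state c to the letter η(c)[d]), and along it
-- E = η^{q-1}(m_{q-1}) ⋯ η^0(m_0) followed by a_0 is a prefix of η^q(x).  As u is fixed by η^p, it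
-- spells η^{tp}(u_0) rightwards from position 0 and η^{tp}(u_{-1}) leftwards from position -1.
-- Hence an accepted word 0 W with |W| = tp represents n = |E|, which is ≥ 1 when the top p digits
-- are not all 0; and 1 W represents n = |E| - |η^{tp}(u_{-1})|, which is ≤ -2 when the top block
-- η^{p-1}(m_{tp-1}) ⋯ η^0(m_{tp-p}) a_{tp-p} is not all of η^p(u_{-1}), i.e. when W does not
-- start with W_max.

open import Defs
open import Data.Nat using (ℕ; zero; suc; _+_; _*_; _∸_; _≤_; _<_; _⊔_; z≤n; s≤s; z<s; _≟_; _≤?_; _<?_)
open import Data.Nat.Properties
open import Data.Nat.Tactic.RingSolver using (solve-∀)
import Data.Integer as ℤ
open ℤ using (ℤ; -[1+_]; _⊖_)
import Data.Integer.Properties as ℤP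
open import Data.Fin using (Fin)
open import Data.List using (List; []; _∷_; _++_; _∷ʳ_; length; replicate; take; foldr; map)
open import Data.List.Properties using (length-++; length-++-≤ˡ; ++-assoc; ++-identityʳ; ∷-injective; ∷-injectiveʳ; concatMap-++; ++-conicalˡ; ++-conicalʳ)
open import Data.List.NonEmpty using (_∷_)
open import Data.List.Reverse using (Reverse; []; _∶_∶ʳ_; reverseView)
open import Data.List.Membership.Propositional using (_∈_)
open import Data.List.Membership.Propositional.Properties using (∈-allFin)
open import Data.List.Relation.Unary.All using (All; []; _∷_)
open import Data.List.Relation.Unary.Any using (here; there)
open import Data.Maybe using (just)
open import Data.Maybe.Properties using (just-injective)
open import Data.Product using (Σ; ∃; _×_; _,_; proj₁; proj₂)
import Data.Product as Product
open import Data.Empty using (⊥-elim)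
open import Data.Unit using (tt)
open import Function using (_∘_)
open import Function.Bundles using (_⇔_; mk⇔)
open import Relation.Binary.PropositionalEquality
open import Relation.Nullary using (¬_; yes; no)

module _ {X : Set} where

  nth?-++ˡ : ∀ (xs ys : List X) {i} → i < length xs → nth? (xs ++ ys) i ≡ nth? xs i
  nth?-++ˡ (x ∷ xs) ys {zero}  _        = refl
  nth?-++ˡ (x ∷ xs) ys {suc i} (s≤s i<) = nth?-++ˡ xs ys i<

  nth?-++ʳ : ∀ (xs ys : List X) i → nth? (xs ++ ys) (length xs + i) ≡ nth? ys i
  nth?-++ʳ []       ys i = refl
  nth?-++ʳ (x ∷ xs) ys i = nth?-++ʳ xs ys i

  nthD≡nth? : ∀ d (xs : List X) {i} → i < length xs → just (nthD d xs i) ≡ nth? xs i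
  nthD≡nth? d (x ∷ xs) {zero}  _        = refl
  nthD≡nth? d (x ∷ xs) {suc i} (s≤s i<) = nthD≡nth? d xs i<

  nth?⇒take-⊑ : ∀ (xs : List X) {d y} → nth? xs d ≡ just y → (take d xs ++ y ∷ []) ⊑ xs
  nth?⇒take-⊑ (x ∷ xs) {zero}  refl = xs , refl
  nth?⇒take-⊑ (x ∷ xs) {suc d} eq   = Product.map₂ (cong (x ∷_)) (nth?⇒take-⊑ xs eq)

  nth?⇒length-take : ∀ (xs : List X) {d y} → nth? xs d ≡ just y → length (take d xs) ≡ d
  nth?⇒length-take (x ∷ xs) {zero}  _  = refl
  nth?⇒length-take (x ∷ xs) {suc d} eq = cong suc (nth?⇒length-take xs eq)

  ⊑⇒nth? : ∀ xs {y} {ys : List X} → (xs ++ y ∷ []) ⊑ ys → nth? ys (length xs) ≡ just y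
  ⊑⇒nth? []       (_ , refl) = refl
  ⊑⇒nth? (x ∷ xs) (t , refl) = ⊑⇒nth? xs (t , refl)

  ⊑⇒length< : ∀ xs {y} {ys : List X} → (xs ++ y ∷ []) ⊑ ys → length xs < length ys
  ⊑⇒length< []       (_ , refl) = s≤s z≤n
  ⊑⇒length< (x ∷ xs) (t , refl) = s≤s (⊑⇒length< xs (t , refl))

  ⊑-unique : ∀ xs xs' {y y'} {ys : List X} → (xs ++ y ∷ []) ⊑ ys → (xs' ++ y' ∷ []) ⊑ ys →
             length xs ≡ length xs' → xs ≡ xs' × y ≡ y'
  ⊑-unique []       []         (_ , refl) (_ , refl) _   = refl , refl
  ⊑-unique (x ∷ xs) (x' ∷ xs') (t , refl) (t' , e)   len with ∷-injective e
  ... | refl , e' = Product.map₁ (cong (x ∷_)) (⊑-unique xs xs' (t , refl) (t' , e') (suc-injective len))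

  ++-injectiveˡ : ∀ (xs xs' : List X) {ys ys'} → xs ++ ys ≡ xs' ++ ys' → length xs ≡ length xs' → xs ≡ xs'
  ++-injectiveˡ []       []         _ _   = refl
  ++-injectiveˡ (x ∷ xs) (x' ∷ xs') e len with ∷-injective e
  ... | refl , e' = cong (x ∷_) (++-injectiveˡ xs xs' e' (suc-injective len))

  length-∷ʳ : ∀ (xs : List X) x → length (xs ∷ʳ x) ≡ suc (length xs)
  length-∷ʳ xs x = trans (length-++ xs) (+-comm (length xs) 1)

  ≢[]⇒0<length : ∀ {xs : List X} → xs ≢ [] → 0 < length xs
  ≢[]⇒0<length {[]}    xs≢[] = ⊥-elim (xs≢[] refl)
  ≢[]⇒0<length {_ ∷ _} _     = s≤s z≤n

  length≡0⇒[] : ∀ {xs : List X} → length xs ≡ 0 → xs ≡ []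
  length≡0⇒[] {[]} _ = refl

module _ {X : Set} (m : ℕ → List X) where

  length-digits : ∀ q → length (digits m q) ≡ q
  length-digits zero    = refl
  length-digits (suc q) = cong suc (length-digits q)

  digits-+ : ∀ len lo → digits m (len + lo) ≡ digits (m ∘ (lo +_)) len ++ digits m lo
  digits-+ zero      lo = refl
  digits-+ (suc len) lo = cong₂ _∷_ (cong (length ∘ m) (+-comm len lo)) (digits-+ len lo)

  replicate⊑digits⇒segment≡[] : ∀ len lo → replicate len 0 ⊑ digits m (len + lo) → segment m lo len ≡ []
  replicate⊑digits⇒segment≡[] zero      lo _       = refl
  replicate⊑digits⇒segment≡[] (suc len) lo (t , e) with ∷-injective e
  ... | 0≡ , e' = cong₂ _++_ (length≡0⇒[] (trans (cong (length ∘ m) (+-comm lo len)) (sym 0≡)))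
                            (replicate⊑digits⇒segment≡[] len lo (t , e'))

  segment≡[]⇒replicate⊑digits : ∀ len lo → segment m lo len ≡ [] → replicate len 0 ⊑ digits m (len + lo)
  segment≡[]⇒replicate⊑digits zero      lo _ = digits m lo , refl
  segment≡[]⇒replicate⊑digits (suc len) lo e with segment≡[]⇒replicate⊑digits len lo (++-conicalʳ (m (lo + len)) _ e)
  ... | t , e' = t , cong₂ _∷_ (sym (trans (cong (length ∘ m) (+-comm len lo))
                                          (cong length (++-conicalˡ (m (lo + len)) _ e)))) e'

digits-cong : ∀ {X : Set} {m m' : ℕ → List X} q → (∀ i → i < q → m i ≡ m' i) → digits m q ≡ digits m' q
digits-cong zero    _    = refl
digits-cong (suc q) m≡m' = cong₂ _∷_ (cong length (m≡m' q ≤-refl)) (digits-cong q (λ i i<q → m≡m' i (m≤n⇒m≤1+n i<q)))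

setAt : ∀ {X : Set} → (ℕ → X) → ℕ → X → ℕ → X
setAt f q v i with i ≟ q
... | yes _ = v
... | no  _ = f i

setAt-≡ : ∀ {X : Set} (f : ℕ → X) q v → setAt f q v q ≡ v
setAt-≡ f q v with q ≟ q
... | yes _   = refl
... | no  q≢q = ⊥-elim (q≢q refl)

setAt-≢ : ∀ {X : Set} (f : ℕ → X) q v {i} → i ≢ q → setAt f q v i ≡ f i
setAt-≢ f q v {i} i≢q with i ≟ q
... | yes i≡q = ⊥-elim (i≢q i≡q)
... | no  _   = refl

≤-foldr-⊔ : ∀ {X : Set} (f : X → ℕ) {xs c} → c ∈ xs → f c ≤ foldr _⊔_ 0 (map f xs)
≤-foldr-⊔ f {x ∷ xs} (here refl) = m≤m⊔n (f x) _
≤-foldr-⊔ f {x ∷ xs} (there c∈) = m≤n⇒m≤o⊔n (f x) (≤-foldr-⊔ f c∈)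

-L+i≡-[1+n] : ∀ {n i L} → suc (n + i) ≡ L → ℤ.- ℤ.+ L ℤ.+ ℤ.+ i ≡ -[1+ n ]
-L+i≡-[1+n] {n} {i} refl = begin
  ℤ.- ℤ.+ suc (n + i) ℤ.+ ℤ.+ i  ≡⟨ ℤP.-m+n≡n⊖m (suc (n + i)) i ⟩
  i ⊖ suc (n + i)                ≡⟨ cong₂ _⊖_ (+-identityʳ i) (trans (+-suc i n) (cong suc (+-comm i n))) ⟨
  (i + 0) ⊖ (i + suc n)          ≡⟨ ℤP.+-cancelˡ-⊖ i 0 (suc n) ⟩
  -[1+ n ]                       ∎
  where open ≡-Reasoning

-- Iterates of η and admissible sequences

module _ {k : ℕ} (η : Subst k) where

  length-img-suc : ∀ c → ∃ λ l → length (img η c) ≡ suc l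
  length-img-suc c with η c
  ... | _ ∷ xs = length xs , refl

  length-img>0 : ∀ c → 0 < length (img η c)
  length-img>0 c with η c
  ... | _ ∷ _ = s≤s z≤n

  applyW-++ : ∀ (xs ys : List (Fin k)) → applyW η (xs ++ ys) ≡ applyW η xs ++ applyW η ys
  applyW-++ = concatMap-++ (img η)

  applyW-∷ʳ : ∀ (xs : List (Fin k)) c → applyW η (xs ∷ʳ c) ≡ applyW η xs ++ img η c
  applyW-∷ʳ xs c = trans (applyW-++ xs (c ∷ [])) (cong (applyW η xs ++_) (++-identityʳ (img η c)))

  iterW-++ : ∀ j (xs ys : List (Fin k)) → iterW η j (xs ++ ys) ≡ iterW η j xs ++ iterW η j ys
  iterW-++ zero    xs ys = refl
  iterW-++ (suc j) xs ys = trans (cong (applyW η) (iterW-++ j xs ys)) (applyW-++ (iterW η j xs) (iterW η j ys))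

  iterW-+ : ∀ i j w → iterW η (i + j) w ≡ iterW η i (iterW η j w)
  iterW-+ zero    j w = refl
  iterW-+ (suc i) j w = cong (applyW η) (iterW-+ i j w)

  iterW-[] : ∀ j → iterW η j [] ≡ []
  iterW-[] zero    = refl
  iterW-[] (suc j) = cong (applyW η) (iterW-[] j)

  iterW-suc-singleton : ∀ x j → iterW η (suc j) (x ∷ []) ≡ iterW η j (img η x)
  iterW-suc-singleton x j = begin
    iterW η (suc j) (x ∷ [])      ≡⟨ cong (λ i → iterW η i (x ∷ [])) (+-comm 1 j) ⟩
    iterW η (j + 1) (x ∷ [])      ≡⟨ iterW-+ j 1 (x ∷ []) ⟩
    iterW η j (img η x ++ [])     ≡⟨ cong (iterW η j) (++-identityʳ (img η x)) ⟩
    iterW η j (img η x)           ∎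
    where open ≡-Reasoning

  length-iterW-++-∷ : ∀ j xs y ys → length (iterW η j (xs ++ y ∷ ys)) ≡
                      length (iterW η j xs) + (length (iterW η j (y ∷ [])) + length (iterW η j ys))
  length-iterW-++-∷ j xs y ys = begin
    length (iterW η j (xs ++ y ∷ ys))
      ≡⟨ cong length (iterW-++ j xs (y ∷ ys)) ⟩
    length (iterW η j xs ++ iterW η j ((y ∷ []) ++ ys))
      ≡⟨ length-++ (iterW η j xs) ⟩
    length (iterW η j xs) + length (iterW η j ((y ∷ []) ++ ys))
      ≡⟨ cong (λ zs → length (iterW η j xs) + length zs) (iterW-++ j (y ∷ []) ys) ⟩
    length (iterW η j xs) + length (iterW η j (y ∷ []) ++ iterW η j ys)
      ≡⟨ cong (λ n → length (iterW η j xs) + n) (length-++ (iterW η j (y ∷ []))) ⟩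
    length (iterW η j xs) + (length (iterW η j (y ∷ [])) + length (iterW η j ys)) ∎
    where open ≡-Reasoning

  length≤length-applyW : ∀ w → length w ≤ length (applyW η w)
  length≤length-applyW []      = z≤n
  length≤length-applyW (c ∷ w) = subst (suc (length w) ≤_) (sym (length-++ (img η c)))
                               (+-mono-≤ (length-img>0 c) (length≤length-applyW w))

  length≤length-iterW : ∀ j w → length w ≤ length (iterW η j w)
  length≤length-iterW zero    w = ≤-refl
  length≤length-iterW (suc j) w = ≤-trans (length≤length-iterW j w) (length≤length-applyW (iterW η j w))

  expandFrom≡expand : ∀ (m : ℕ → List (Fin k)) lo len → expandFrom η m lo len ≡ expand η (m ∘ (lo +_)) len
  expandFrom≡expand m lo zero      = refl
  expandFrom≡expand m lo (suc len) = cong (iterW η len (m (lo + len)) ++_) (expandFrom≡expand m lo len)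

  expand-+ : ∀ (m : ℕ → List (Fin k)) len lo →
             expand η m (len + lo) ≡ iterW η lo (expandFrom η m lo len) ++ expand η m lo
  expand-+ m zero      lo = cong (_++ expand η m lo) (sym (iterW-[] lo))
  expand-+ m (suc len) lo = begin
    iterW η (len + lo) (m (len + lo)) ++ expand η m (len + lo)
      ≡⟨ cong₂ _++_ top (expand-+ m len lo) ⟩
    iterW η lo (iterW η len (m (lo + len))) ++ iterW η lo (expandFrom η m lo len) ++ expand η m lo
      ≡⟨ sym (++-assoc (iterW η lo (iterW η len (m (lo + len)))) _ _) ⟩
    (iterW η lo (iterW η len (m (lo + len))) ++ iterW η lo (expandFrom η m lo len)) ++ expand η m lo
      ≡⟨ cong (_++ expand η m lo) (sym (iterW-++ lo (iterW η len (m (lo + len))) _)) ⟩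
    iterW η lo (expandFrom η m lo (suc len)) ++ expand η m lo ∎
    where
    open ≡-Reasoning
    top : iterW η (len + lo) (m (len + lo)) ≡ iterW η lo (iterW η len (m (lo + len)))
    top = trans (cong (λ i → iterW η i (m i)) (+-comm len lo)) (iterW-+ lo len (m (lo + len)))

  expand-cong : ∀ {m m' : ℕ → List (Fin k)} q → (∀ i → i < q → m i ≡ m' i) → expand η m q ≡ expand η m' q
  expand-cong zero    _    = refl
  expand-cong (suc q) m≡m' = cong₂ _++_ (cong (iterW η q) (m≡m' q ≤-refl))
                                        (expand-cong q (λ i i<q → m≡m' i (m≤n⇒m≤1+n i<q)))

  length-segment≤ : ∀ (m : ℕ → List (Fin k)) lo len → length (segment m lo len) ≤ length (expandFrom η m lo len)
  length-segment≤ m lo zero      = z≤n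
  length-segment≤ m lo (suc len) =
    subst₂ _≤_ (sym (length-++ (m (lo + len)))) (sym (length-++ (iterW η len (m (lo + len)))))
      (+-mono-≤ (length≤length-iterW len (m (lo + len))) (length-segment≤ m lo len))

  admissible-drop : ∀ {x q m a} → Admissible η x (suc q) m a → Admissible η (a q) q m a
  admissible-drop {q = zero}  _            = tt
  admissible-drop {q = suc q} (links , _) = (λ i i<q → links i (m≤n⇒m≤1+n i<q)) , links q ≤-refl

  admissible-bottom : ∀ {x} len lo {m a} → Admissible η x (suc len + lo) m a → Admissible η (a lo) lo m a
  admissible-bottom zero      lo adm = admissible-drop adm
  admissible-bottom (suc len) lo adm = admissible-bottom len lo (admissible-drop adm)

  admissible-top : ∀ {x} len lo {m a} → Admissible η x (len + lo) m a →
                   Admissible η x len (m ∘ (lo +_)) (a ∘ (lo +_))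
  admissible-top zero      lo _             = tt
  admissible-top {x} (suc len) lo {m} {a} (links , top) =
    (λ i i<len → subst (λ j → (m (lo + i) ++ a (lo + i) ∷ []) ⊑ img η (a j)) (sym (+-suc lo i))
                   (links (lo + i) (subst (lo + i <_) (+-comm lo len) (+-monoʳ-< lo i<len)))) ,
    subst (λ j → (m j ++ a j ∷ []) ⊑ img η x) (+-comm len lo) top

  admissible-unique : ∀ {x} q {m a m' a'} → Admissible η x q m a → Admissible η x q m' a' →
                      digits m q ≡ digits m' q → ∀ i → i < q → m i ≡ m' i × a i ≡ a' i
  admissible-unique (suc q) {m} {a} {m'} {a'} adm adm' ds≡ i i<q
    with ⊑-unique (m q) (m' q) (proj₂ adm) (proj₂ adm') (proj₁ (∷-injective ds≡))
  ... | mq≡ , aq≡ with i ≟ q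
  ...   | yes refl = mq≡ , aq≡
  ...   | no  i≢q  = admissible-unique q (admissible-drop adm)
                       (subst (λ y → Admissible η y q m' a') (sym aq≡) (admissible-drop adm'))
                       (proj₂ (∷-injective ds≡)) i (≤∧≢⇒< (≤-pred i<q) i≢q)

  admissible-link : ∀ {y q m a} → Admissible η y q m a →
                    ∀ i → i < q → (m i ++ a i ∷ []) ⊑ img η (setAt a q y (suc i))
  admissible-link {y} {suc q} {m} {a} (links , top) i i<q with i ≟ q
  ... | yes refl rewrite setAt-≡ a (suc i) y = top
  ... | no  i≢q  rewrite setAt-≢ a (suc q) y (i≢q ∘ suc-injective) = links i (≤∧≢⇒< (≤-pred i<q) i≢q)

  admissible-extend : ∀ {x y q m a mt} → Admissible η y q m a → (mt ++ y ∷ []) ⊑ img η x →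
                      Admissible η x (suc q) (setAt m q mt) (setAt a q y)
  admissible-extend {x} {y} {q} {m} {a} {mt} adm top =
    lower , subst₂ (λ ms b → (ms ++ b ∷ []) ⊑ img η x) (sym (setAt-≡ m q mt)) (sym (setAt-≡ a q y)) top
    where
    lower : ∀ i → i < q → (setAt m q mt i ++ setAt a q y i ∷ []) ⊑ img η (setAt a q y (suc i))
    lower i i<q rewrite setAt-≢ m q mt (<⇒≢ i<q) | setAt-≢ a q y (<⇒≢ i<q) = admissible-link adm i i<q

  ExpansionPrefix : ∀ (x : Fin k) q (m : ℕ → List (Fin k)) (a : ℕ → Fin k) → Set
  ExpansionPrefix x q m a = ∃ λ R → iterW η q (x ∷ []) ≡ expand η m q ++ a 0 ∷ R

  extend-prefix : ∀ {y q m a} → (m q ++ a q ∷ []) ⊑ img η y → ExpansionPrefix (a q) q m a → ExpansionPrefix y (suc q) m a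
  extend-prefix {y} {q} {m} {a} (t , e) (R , eR) = R ++ iterW η q t , (begin
    iterW η (suc q) (y ∷ [])
      ≡⟨ iterW-suc-singleton y q ⟩
    iterW η q (img η y)
      ≡⟨ cong (iterW η q) (trans (sym e) (++-assoc (m q) _ t)) ⟩
    iterW η q (m q ++ (a q ∷ []) ++ t)
      ≡⟨ trans (iterW-++ q (m q) _) (cong (iterW η q (m q) ++_) (iterW-++ q (a q ∷ []) t)) ⟩
    iterW η q (m q) ++ iterW η q (a q ∷ []) ++ iterW η q t
      ≡⟨ cong (λ zs → iterW η q (m q) ++ zs ++ iterW η q t) eR ⟩
    iterW η q (m q) ++ (expand η m q ++ a 0 ∷ R) ++ iterW η q t
      ≡⟨ cong (iterW η q (m q) ++_) (++-assoc (expand η m q) _ _) ⟩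
    iterW η q (m q) ++ expand η m q ++ a 0 ∷ R ++ iterW η q t
      ≡⟨ sym (++-assoc (iterW η q (m q)) _ _) ⟩
    expand η m (suc q) ++ a 0 ∷ R ++ iterW η q t ∎)
    where open ≡-Reasoning

  admissible⇒prefix : ∀ {x} q {m a} → Admissible η x (suc q) m a → ExpansionPrefix x (suc q) m a
  admissible⇒prefix zero    {m} {a} (_ , top)     = extend-prefix {q = 0} {m} {a} top ([] , refl)
  admissible⇒prefix (suc q) {m} {a} adm@(_ , top) =
    extend-prefix {q = suc q} {m} {a} top (admissible⇒prefix q (admissible-drop adm))

  admissible⇒expand⊑ : ∀ {x} q {m a} → Admissible η x (suc q) m a → expand η m (suc q) ⊑ iterW η (suc q) (x ∷ [])
  admissible⇒expand⊑ q {a = a} adm = let R , eR = admissible⇒prefix q adm in a 0 ∷ R , sym eR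

  admissible⇒length< : ∀ {y} q {m a} → Admissible η y q m a → length (expand η m q) < length (iterW η q (y ∷ []))
  admissible⇒length< zero    _           = s≤s z≤n
  admissible⇒length< (suc q) {m} {a} adm with admissible⇒prefix q adm
  ... | R , eR = subst (length (expand η m (suc q)) <_)
                   (sym (trans (cong length eR) (length-++ (expand η m (suc q))))) (m<m+n _ (s≤s z≤n))

  admissible-last : ∀ {x} q {m a} → Admissible η x (suc q) m a →
                    length (iterW η (suc q) (x ∷ [])) ∸ 1 ≡ length (expand η m (suc q)) →
                    iterW η (suc q) (x ∷ []) ≡ expand η m (suc q) ++ a 0 ∷ []
  admissible-last {x} q {m} {a} adm len≡ with admissible⇒prefix q adm
  ... | R , eR = trans eR (cong (λ zs → expand η m (suc q) ++ a 0 ∷ zs) (length≡0⇒[] (+-cancelˡ-≡ (length E) _ _ E+R≡E+0)))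
    where
    E = expand η m (suc q)
    E+R≡E+0 : length E + length R ≡ length E + 0
    E+R≡E+0 = begin
      length E + length R              ≡⟨ cong (_∸ 1) (sym (+-suc (length E) (length R))) ⟩
      (length E + suc (length R)) ∸ 1  ≡⟨ cong (_∸ 1) (sym (trans (cong length eR) (length-++ E))) ⟩
      length (iterW η (suc q) (x ∷ [])) ∸ 1 ≡⟨ len≡ ⟩
      length E                         ≡⟨ +-identityʳ (length E) ⟨
      length E + 0                     ∎
      where open ≡-Reasoning

  admissible-top-prefix : ∀ {x} len lo {m a} → Admissible η x (suc len + lo) m a →
                          ∃ λ R → iterW η (suc len) (x ∷ []) ≡ expandFrom η m lo (suc len) ++ a lo ∷ R
  admissible-top-prefix len lo {m} {a} adm with admissible⇒prefix len (admissible-top (suc len) lo adm)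
  ... | R , eR = R , trans eR (cong₂ (λ zs b → zs ++ b ∷ R) (sym (expandFrom≡expand m lo (suc len)))
                                                          (cong a (+-identityʳ lo)))

  TailRel-last⇒top-block≡ : ∀ {x} len lo {m a W} → Admissible η x (suc len + lo) m a →
                TailRel η (suc len) x (length (iterW η (suc len) (x ∷ [])) ∸ 1) W →
                W ⊑ digits m (suc len + lo) →
                expandFrom η m lo (suc len) ++ a lo ∷ [] ≡ iterW η (suc len) (x ∷ [])
  TailRel-last⇒top-block≡ {x} len lo {m} {a} adm (m' , a' , adm' , len≡ , refl) (t , e) = begin
    expandFrom η m lo (suc len) ++ a lo ∷ []
      ≡⟨ cong₂ (λ zs b → zs ++ b ∷ []) (expandFrom≡expand m lo (suc len)) (cong a (sym (+-identityʳ lo))) ⟩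
    expand η (m ∘ (lo +_)) (suc len) ++ a (lo + 0) ∷ []
      ≡⟨ cong₂ (λ zs b → zs ++ b ∷ []) (sym (expand-cong (suc len) (λ i i< → proj₁ (same i i<))))
                                       (sym (proj₂ (same 0 (s≤s z≤n)))) ⟩
    expand η m' (suc len) ++ a' 0 ∷ []
      ≡⟨ admissible-last len adm' len≡ ⟨
    iterW η (suc len) (x ∷ []) ∎
    where
    open ≡-Reasoning
    same : ∀ i → i < suc len → m' i ≡ m (lo + i) × a' i ≡ a (lo + i)
    same = admissible-unique (suc len) adm' (admissible-top (suc len) lo adm)
             (++-injectiveˡ _ _ (trans e (digits-+ m (suc len) lo))
                (trans (length-digits m' (suc len)) (sym (length-digits (m ∘ (lo +_)) (suc len)))))

  top-block≡⇒TailRel-last : ∀ {x} len lo {m a} → Admissible η x (suc len + lo) m a →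
                        expandFrom η m lo (suc len) ++ a lo ∷ [] ≡ iterW η (suc len) (x ∷ []) →
                        TailRel η (suc len) x (length (iterW η (suc len) (x ∷ [])) ∸ 1) (digits (m ∘ (lo +_)) (suc len))
  top-block≡⇒TailRel-last {x} len lo {m} {a} adm top≡ =
    m ∘ (lo +_) , a ∘ (lo +_) , admissible-top (suc len) lo adm , len≡ , refl
    where
    open ≡-Reasoning
    len≡ : length (iterW η (suc len) (x ∷ [])) ∸ 1 ≡ length (expand η (m ∘ (lo +_)) (suc len))
    len≡ = begin
      length (iterW η (suc len) (x ∷ [])) ∸ 1            ≡⟨ cong (λ zs → length zs ∸ 1) top≡ ⟨
      length (expandFrom η m lo (suc len) ∷ʳ a lo) ∸ 1   ≡⟨ cong (_∸ 1) (length-∷ʳ (expandFrom η m lo (suc len)) (a lo)) ⟩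
      length (expandFrom η m lo (suc len))              ≡⟨ cong length (expandFrom≡expand m lo (suc len)) ⟩
      length (expand η (m ∘ (lo +_)) (suc len))         ∎

  top-block≢⇒gap : ∀ {x} len lo {m a} → Admissible η x (suc len + lo) m a →
                    expandFrom η m lo (suc len) ++ a lo ∷ [] ≢ iterW η (suc len) (x ∷ []) →
                    length (expand η m (suc len + lo)) + 2 ≤ length (iterW η (suc len + lo) (x ∷ []))
  top-block≢⇒gap {x} len lo {m} {a} adm ≢ with admissible-top-prefix len lo adm
  ... | []    , eR = ⊥-elim (≢ (sym eR))
  ... | r ∷ R , eR = begin
    length (expand η m (suc len + lo)) + 2
      ≡⟨ cong (_+ 2) (trans (cong length (expand-+ m (suc len) lo)) (length-++ (iterW η lo Ef))) ⟩
    length (iterW η lo Ef) + length (expand η m lo) + 2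
      ≡⟨ +-assoc (length (iterW η lo Ef)) _ 2 ⟩
    length (iterW η lo Ef) + (length (expand η m lo) + 2)
      ≡⟨ cong (length (iterW η lo Ef) +_) (+-suc _ 1) ⟩
    length (iterW η lo Ef) + (suc (length (expand η m lo)) + 1)
      ≤⟨ +-monoʳ-≤ (length (iterW η lo Ef))
           (+-mono-≤ (admissible⇒length< lo (admissible-bottom len lo adm))
                     (≤-trans (s≤s z≤n) (length≤length-iterW lo (r ∷ R)))) ⟩
    length (iterW η lo Ef) + (length (iterW η lo (a lo ∷ [])) + length (iterW η lo (r ∷ R)))
      ≡⟨ length-iterW-++-∷ lo Ef (a lo) (r ∷ R) ⟨
    length (iterW η lo (Ef ++ a lo ∷ r ∷ R))
      ≡⟨ cong (length ∘ iterW η lo) eR ⟨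
    length (iterW η lo (iterW η (suc len) (x ∷ [])))
      ≡⟨ cong length (trans (sym (iterW-+ lo (suc len) (x ∷ []))) (cong (λ i → iterW η i (x ∷ [])) (+-comm lo (suc len)))) ⟩
    length (iterW η (suc len + lo) (x ∷ [])) ∎
    where
    open ≤-Reasoning
    Ef = expandFrom η m lo (suc len)

  segment≢[]⇒0<length-expand : ∀ (m : ℕ → List (Fin k)) len lo → segment m lo len ≢ [] →
                                0 < length (expand η m (len + lo))
  segment≢[]⇒0<length-expand m len lo seg≢[] = begin-strict
    0                                                   <⟨ ≢[]⇒0<length seg≢[] ⟩
    length (segment m lo len)                           ≤⟨ length-segment≤ m lo len ⟩
    length (expandFrom η m lo len)                      ≤⟨ length≤length-iterW lo _ ⟩
    length (iterW η lo (expandFrom η m lo len))         ≤⟨ m≤m+n _ _ ⟩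
    length (iterW η lo (expandFrom η m lo len)) + length (expand η m lo)
      ≡⟨ length-++ (iterW η lo (expandFrom η m lo len)) ⟨
    length (iterW η lo (expandFrom η m lo len) ++ expand η m lo)
      ≡⟨ cong length (expand-+ m len lo) ⟨
    length (expand η m (len + lo))                      ∎
    where open ≤-Reasoning

  length-iterW≤length : (∀ c → length (img η c) ≤ 1) → ∀ j w → length (iterW η j w) ≤ length w
  length-iterW≤length short zero    w = ≤-refl
  length-iterW≤length short (suc j) w = ≤-trans (length-applyW≤length (iterW η j w)) (length-iterW≤length short j w)
    where
    length-applyW≤length : ∀ w → length (applyW η w) ≤ length w
    length-applyW≤length []      = z≤n
    length-applyW≤length (c ∷ w) = subst (_≤ suc (length w)) (sym (length-++ (img η c)))
                               (+-mono-≤ (short c) (length-applyW≤length w))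

  length-img≤maxLen : ∀ c → length (img η c) ≤ maxLen η
  length-img≤maxLen c = ≤-foldr-⊔ (λ c → length (img η c)) (∈-allFin c)

  1<maxLen : IsSubstitution η → 1 < maxLen η
  1<maxLen (a , growing) with 1 <? maxLen η
  ... | yes 1<max = 1<max
  ... | no  1≮max with growing 2
  ...   | j , 2≤ = ⊥-elim (1+n≰n (≤-trans 2≤ (length-iterW≤length short j (a ∷ []))))
    where
    short : ∀ c → length (img η c) ≤ 1
    short c = ≤-trans (length-img≤maxLen c) (≮⇒≥ 1≮max)

  digits<maxLen : ∀ {x} q {m a} → Admissible η x q m a → All (_< maxLen η) (digits m q)
  digits<maxLen zero                _   = []
  digits<maxLen {x} (suc q) {m} adm = ≤-trans (⊑⇒length< (m q) (proj₂ adm)) (length-img≤maxLen x)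
                                      ∷ digits<maxLen q (admissible-drop adm)

module _ {k : ℕ} (η : Subst k) (u : ℤ → Fin k) where

  δ*-digits : ∀ {x} q {m a} → Admissible η x (suc q) m a → δ* η u (letter x) (digits m (suc q)) ≡ just (letter (a 0))
  δ*-digits zero    {m} (_ , top)       rewrite ⊑⇒nth? (m 0) top = refl
  δ*-digits (suc q) {m} adm@(_ , top) rewrite ⊑⇒nth? (m (suc q)) top = δ*-digits q (admissible-drop η adm)

  δ*⇒admissible : ∀ {x c} q ds → length ds ≡ q → δ* η u (letter x) ds ≡ just (letter c) →
                  Σ (ℕ → List (Fin k)) λ m → Σ (ℕ → Fin k) λ a → Admissible η x q m a × ds ≡ digits m q
  δ*⇒admissible {x} zero    []       _  _    = (λ _ → []) , (λ _ → x) , tt , refl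
  δ*⇒admissible {x} (suc q) (d ∷ ds) len path with nth? (img η x) d in eq
  ... | just y with δ*⇒admissible q ds (suc-injective len) path
  ...   | m , a , adm , ds≡ =
    setAt m q (take d (img η x)) , setAt a q y ,
    admissible-extend η adm (nth?⇒take-⊑ (img η x) eq) ,
    cong₂ _∷_ (trans (sym (nth?⇒length-take (img η x) eq)) (cong length (sym (setAt-≡ m q _))))
              (trans ds≡ (digits-cong q (λ i i<q → sym (setAt-≢ m q _ (<⇒≢ i<q)))))

-- Reading η^q(w) off a periodic point

module _ {X : Set} where

  record Reads (v : ℤ → X) (z : ℤ) (w : List X) : Set where
    constructor reads
    field read : ∀ i → i < length w → just (v (z ℤ.+ ℤ.+ i)) ≡ nth? w i

  -- v_{-m0-|W|} ⋯ v_{-m0-1} = W: the letter of W at index d lies n places left of its right end.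
  record ReadsBack (v : ℤ → X) (m0 : ℕ) (W : List X) : Set where
    constructor readsBack
    field readBack : ∀ n d → suc (n + d) ≡ length W → just (v -[1+ (m0 + n) ]) ≡ nth? W d

  open Reads
  open ReadsBack

  Reads-⊑ : ∀ {v z} {xs ys : List X} → xs ⊑ ys → Reads v z ys → Reads v z xs
  Reads-⊑ {xs = xs} (t , refl) r =
    reads λ i i< → trans (read r i (≤-trans i< (length-++-≤ˡ xs))) (nth?-++ˡ xs t i<)

  Reads-≗ : ∀ {v v' z w} → (∀ y → v y ≡ v' y) → Reads v z w → Reads v' z w
  Reads-≗ v≗v' r = reads λ i i< → trans (cong just (sym (v≗v' _))) (read r i i<)

  ReadsBack-≗ : ∀ {v v' m0 W} → (∀ y → v y ≡ v' y) → ReadsBack v m0 W → ReadsBack v' m0 W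
  ReadsBack-≗ v≗v' r = readsBack λ n d e → trans (cong just (sym (v≗v' _))) (readBack r n d e)

  Reads-[_] : ∀ v z → Reads v z (v z ∷ [])
  Reads-[ v ] z = reads λ where
    zero    _        → cong (just ∘ v) (ℤP.+-identityʳ z)
    (suc i) (s≤s ())

  ReadsBack-[_] : ∀ v → ReadsBack v 0 (v -[1+ 0 ] ∷ [])
  ReadsBack-[ v ] = readsBack λ where
    zero    zero    _  → refl
    zero    (suc d) ()
    (suc n) d       ()

  Reads-head : ∀ {v z c ws} → Reads v z (c ∷ ws) → v z ≡ c
  Reads-head {v} {z} r = just-injective (trans (cong (just ∘ v) (sym (ℤP.+-identityʳ z))) (read r 0 (s≤s z≤n)))

  Reads-tail : ∀ {v m0 c ws} → Reads v (ℤ.+ m0) (c ∷ ws) → Reads v (ℤ.+ (m0 + 1)) ws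
  Reads-tail {v} {m0} r = reads λ i i< → trans (cong (just ∘ v ∘ ℤ.+_) (+-assoc m0 1 i)) (read r (suc i) (s≤s i<))

  ReadsBack-last : ∀ {v m0 ws c} → ReadsBack v m0 (ws ∷ʳ c) → v -[1+ m0 ] ≡ c
  ReadsBack-last {v} {m0} {ws} {c} r = just-injective
    (trans (cong (λ j → just (v -[1+ j ])) (sym (+-identityʳ m0)))
           (trans (readBack r 0 (length ws) (sym (length-∷ʳ ws c))) (⊑⇒nth? ws ([] , ++-identityʳ (ws ∷ʳ c)))))

  ReadsBack-init : ∀ {v m0 ws c} → ReadsBack v m0 (ws ∷ʳ c) → ReadsBack v (suc m0) ws
  ReadsBack-init {v} {m0} {ws} {c} r = readsBack λ n d e →
    trans (cong (λ j → just (v -[1+ j ])) (sym (+-suc m0 n)))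
          (trans (readBack r (suc n) d (trans (cong suc e) (sym (length-∷ʳ ws c))))
                 (nth?-++ˡ ws (c ∷ []) (subst (d <_) e (s≤s (m≤n+m d n)))))

  ReadsBack⇒Reads : ∀ {v W} → ReadsBack v 0 W → Reads v (ℤ.- ℤ.+ length W) W
  ReadsBack⇒Reads {v} {W} r = reads λ i i< →
    let 1+n+i≡|W| = trans (sym (+-suc (length W ∸ suc i) i)) (m∸n+n≡m i<)
    in trans (cong (just ∘ v) (-L+i≡-[1+n] 1+n+i≡|W|)) (readBack r _ i 1+n+i≡|W|)

module _ {k : ℕ} (η : Subst k) (v : ℤ → Fin k) where

  private
    len : ℤ → ℕ
    len j = length (img η (v j))

  fwd-within : ∀ j i n → i + n < len j → just (fwd η v j i n) ≡ nth? (img η (v j)) (i + n)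
  fwd-within j i zero    lt rewrite +-identityʳ i = nthD≡nth? _ (img η (v j)) lt
  fwd-within j i (suc n) lt with suc i <? len j
  ... | yes _   = subst (λ l → just (fwd η v j (suc i) n) ≡ nth? (img η (v j)) l) (sym (+-suc i n))
                    (fwd-within j (suc i) n (subst (_< len j) (+-suc i n) lt))
  ... | no  i≮ = ⊥-elim (i≮ (≤-<-trans (subst (suc i ≤_) (sym (+-suc i n)) (s≤s (m≤m+n i n))) lt))

  fwd-exit : ∀ j i n l → suc (i + n) ≡ len j → fwd η v j i (suc n + l) ≡ fwd η v (j ℤ.+ ℤ.+ 1) 0 l
  fwd-exit j i zero    l e with suc i <? len j
  ... | yes i< = ⊥-elim (1+n≰n (subst (suc i ≤_) (+-identityʳ i) (≤-pred (subst (suc i <_) (sym e) i<))))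
  ... | no  _  = refl
  fwd-exit j i (suc n) l e with suc i <? len j
  ... | yes _  = fwd-exit j (suc i) n l (trans (cong suc (sym (+-suc i n))) e)
  ... | no  i≮ = ⊥-elim (i≮ (subst (suc i <_) e (s≤s (subst (suc i ≤_) (sym (+-suc i n)) (s≤s (m≤m+n i n))))))

  bwd-within : ∀ j n i → n + i < len j → just (bwd η v j (n + i) n) ≡ nth? (img η (v j)) i
  bwd-within j zero    i lt = nthD≡nth? _ (img η (v j)) lt
  bwd-within j (suc n) i lt = bwd-within j n i (<-trans (n<1+n (n + i)) lt)

  bwd-exit : ∀ m0 i l → bwd η v -[1+ m0 ] i (suc i + l) ≡ bwd η v -[1+ suc m0 ] (len -[1+ suc m0 ] ∸ 1) l
  bwd-exit m0 zero    l = cong (λ j → bwd η v -[1+ suc j ] (len -[1+ suc j ] ∸ 1) l) (+-identityʳ m0)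
  bwd-exit m0 (suc i) l = bwd-exit m0 i l

  private
    len-applyW-∷ʳ : ∀ ws c {l'} → length (img η c) ≡ suc l' →
                    length (applyW η (ws ∷ʳ c)) ≡ length (applyW η ws) + suc l'
    len-applyW-∷ʳ ws c |c|≡ = trans (cong length (applyW-∷ʳ η ws c))
                                (trans (length-++ (applyW η ws)) (cong (length (applyW η ws) +_) |c|≡))

    len-last : ∀ {m0 ws c l} → ReadsBack v m0 (ws ∷ʳ c) → length (img η c) ≡ suc l → len -[1+ m0 ] ≡ suc l
    len-last r |c|≡ = trans (cong (length ∘ img η) (ReadsBack-last r)) |c|≡

    cancel-within : ∀ A n i d → suc (n + d) ≡ A + suc (n + i) → d ≡ A + i
    cancel-within A n i d e = +-cancelˡ-≡ n _ _ (suc-injective (trans e (shuffle A n i)))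
      where
      shuffle : ∀ A n i → A + suc (n + i) ≡ suc (n + (A + i))
      shuffle = solve-∀

    cancel-exit : ∀ A l n d → suc (suc l + n + d) ≡ A + suc l → suc (n + d) ≡ A
    cancel-exit A l n d e = +-cancelʳ-≡ (suc l) _ _ (trans (sym (shuffle l n d)) e)
      where
      shuffle : ∀ l n d → suc (suc l + n + d) ≡ suc (n + d) + suc l
      shuffle = solve-∀

  fwd-reads : ∀ m0 ws → Reads v (ℤ.+ m0) ws → ∀ l → l < length (applyW η ws) →
              just (fwd η v (ℤ.+ m0) 0 l) ≡ nth? (applyW η ws) l
  fwd-reads m0 (c ∷ ws) r l l< with l <? length (img η c)
  ... | yes l<c = begin
    just (fwd η v (ℤ.+ m0) 0 l)  ≡⟨ fwd-within (ℤ.+ m0) 0 l (subst (λ x → l < length (img η x)) (sym (Reads-head r)) l<c) ⟩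
    nth? (img η (v (ℤ.+ m0))) l  ≡⟨ cong (λ x → nth? (img η x) l) (Reads-head r) ⟩
    nth? (img η c) l             ≡⟨ nth?-++ˡ (img η c) (applyW η ws) l<c ⟨
    nth? (applyW η (c ∷ ws)) l   ∎
    where open ≡-Reasoning
  ... | no l≮c with m≤n⇒∃[o]m+o≡n (≮⇒≥ l≮c) | length-img-suc η c
  ...   | l' , refl | n , |c|≡ = begin
    just (fwd η v (ℤ.+ m0) 0 (length (img η c) + l'))
      ≡⟨ cong (λ i → just (fwd η v (ℤ.+ m0) 0 (i + l'))) |c|≡ ⟩
    just (fwd η v (ℤ.+ m0) 0 (suc n + l'))
      ≡⟨ cong just (fwd-exit (ℤ.+ m0) 0 n l' (trans (sym |c|≡) (cong (length ∘ img η) (sym (Reads-head r))))) ⟩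
    just (fwd η v (ℤ.+ (m0 + 1)) 0 l')
      ≡⟨ fwd-reads (m0 + 1) ws (Reads-tail r) l' (+-cancelˡ-< (length (img η c)) l' _ (subst (length (img η c) + l' <_) (length-++ (img η c)) l<)) ⟩
    nth? (applyW η ws) l'
      ≡⟨ nth?-++ʳ (img η c) (applyW η ws) l' ⟨
    nth? (applyW η (c ∷ ws)) (length (img η c) + l') ∎
    where open ≡-Reasoning

  bwd-reads : ∀ m0 {W} → Reverse W → ReadsBack v m0 W → ∀ n d → suc (n + d) ≡ length (applyW η W) →
              just (bwd η v -[1+ m0 ] (len -[1+ m0 ] ∸ 1) n) ≡ nth? (applyW η W) d
  bwd-reads m0 (ws ∶ rws ∶ʳ c) r n d e with length-img-suc η c
  ... | l' , |c|≡ with n ≤? l'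
  ...   | yes n≤l' with m≤n⇒∃[o]m+o≡n n≤l'
  ...     | i , refl = begin
    just (bwd η v -[1+ m0 ] (len -[1+ m0 ] ∸ 1) n)
      ≡⟨ cong (λ s → just (bwd η v -[1+ m0 ] (s ∸ 1) n)) (len-last r |c|≡) ⟩
    just (bwd η v -[1+ m0 ] (n + i) n)
      ≡⟨ bwd-within -[1+ m0 ] n i (subst (n + i <_) (sym (len-last r |c|≡)) ≤-refl) ⟩
    nth? (img η (v -[1+ m0 ])) i
      ≡⟨ cong (λ x → nth? (img η x) i) (ReadsBack-last r) ⟩
    nth? (img η c) i
      ≡⟨ nth?-++ʳ (applyW η ws) (img η c) i ⟨
    nth? (applyW η ws ++ img η c) (length (applyW η ws) + i)
      ≡⟨ cong₂ nth? (applyW-∷ʳ η ws c) (cancel-within _ n i d (trans e (len-applyW-∷ʳ ws c |c|≡))) ⟨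
    nth? (applyW η (ws ∷ʳ c)) d ∎
    where open ≡-Reasoning
  bwd-reads m0 (ws ∶ rws ∶ʳ c) r n d e | l' , |c|≡ | no n≰l' with m≤n⇒∃[o]m+o≡n (≰⇒> n≰l')
  ... | n' , refl = begin
    just (bwd η v -[1+ m0 ] (len -[1+ m0 ] ∸ 1) (suc l' + n'))
      ≡⟨ cong (λ s → just (bwd η v -[1+ m0 ] (s ∸ 1) (suc l' + n'))) (len-last r |c|≡) ⟩
    just (bwd η v -[1+ m0 ] l' (suc l' + n'))
      ≡⟨ cong just (bwd-exit m0 l' n') ⟩
    just (bwd η v -[1+ suc m0 ] (len -[1+ suc m0 ] ∸ 1) n')
      ≡⟨ bwd-reads (suc m0) rws (ReadsBack-init r) n' d e' ⟩
    nth? (applyW η ws) d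
      ≡⟨ nth?-++ˡ (applyW η ws) (img η c) (subst (d <_) e' (s≤s (m≤n+m d n'))) ⟨
    nth? (applyW η ws ++ img η c) d
      ≡⟨ cong (λ zs → nth? zs d) (applyW-∷ʳ η ws c) ⟨
    nth? (applyW η (ws ∷ʳ c)) d ∎
    where
    open ≡-Reasoning
    e' : suc (n' + d) ≡ length (applyW η ws)
    e' = cancel-exit _ l' n' d (trans e (len-applyW-∷ʳ ws c |c|≡))

  act-reads : ∀ {w} → Reads v (ℤ.+ 0) w → Reads (act η v) (ℤ.+ 0) (applyW η w)
  act-reads {w} r = reads (fwd-reads 0 w r)

  act-readsBack : ∀ {W} → ReadsBack v 0 W → ReadsBack (act η v) 0 (applyW η W)
  act-readsBack {W} r = readsBack (bwd-reads 0 (reverseView W) r)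

module _ {k : ℕ} (η : Subst k) where

  actIter-reads : ∀ q {v w} → Reads v (ℤ.+ 0) w → Reads (actIter η q v) (ℤ.+ 0) (iterW η q w)
  actIter-reads zero    r = r
  actIter-reads (suc q) r = act-reads η _ (actIter-reads q r)

  actIter-readsBack : ∀ q {v W} → ReadsBack v 0 W → ReadsBack (actIter η q v) 0 (iterW η q W)
  actIter-readsBack zero    r = r
  actIter-readsBack (suc q) r = act-readsBack η _ (actIter-readsBack q r)

  module _ {p u} (fixed : FixedBy η p u) where

    fixed⇒Reads-iterW : ∀ {w} → Reads u (ℤ.+ 0) w → ∀ t → Reads u (ℤ.+ 0) (iterW η (t * p) w)
    fixed⇒Reads-iterW     r zero    = r
    fixed⇒Reads-iterW {w} r (suc t) = subst (Reads u (ℤ.+ 0)) (sym (iterW-+ η p (t * p) w))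
                                        (Reads-≗ fixed (actIter-reads p (fixed⇒Reads-iterW r t)))

    fixed⇒ReadsBack-iterW : ∀ {W} → ReadsBack u 0 W → ∀ t → ReadsBack u 0 (iterW η (t * p) W)
    fixed⇒ReadsBack-iterW     r zero    = r
    fixed⇒ReadsBack-iterW {W} r (suc t) = subst (ReadsBack u 0) (sym (iterW-+ η p (t * p) W))
                                            (ReadsBack-≗ fixed (actIter-readsBack p (fixed⇒ReadsBack-iterW r t)))

-- The two inclusions

module _ {k : ℕ} (η : Subst k) (u : ℤ → Fin k) (p' : ℕ) where

  private
    p : ℕ
    p = suc p'

    x₀ x₁ : Fin k
    x₀ = u (ℤ.+ 0)
    x₁ = u -[1+ 0 ]

    length-∷-digits : ∀ d (m : ℕ → List (Fin k)) q → length (d ∷ digits m q) ≡ q + 1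
    length-∷-digits d m q = trans (cong suc (length-digits m q)) (+-comm 1 q)

    0<maxLen : IsSubstitution η → 0 < maxLen η
    0<maxLen = <-trans z<s ∘ 1<maxLen η

  rep⇒rhs : IsSubstitution η → ∀ w → InRepImage η u p w → InRHS η u p w
  rep⇒rhs isS .(0 ∷ []) (ℤ.+ zero , refl) =
    (0 , refl) , (0<maxLen isS ∷ [] , x₀ , refl) , (λ { (_ , ()) }) , (λ { (_ , _ , _ , ()) })
  rep⇒rhs isS .(1 ∷ []) (-[1+ zero ] , refl) =
    (0 , refl) , (1<maxLen η isS ∷ [] , x₁ , refl) , (λ { (_ , ()) }) , (λ { (_ , (_ , _ , _ , _ , refl) , _ , ()) })
  rep⇒rhs isS .(0 ∷ digits m (suc t * p)) (ℤ.+ suc _ , t , m , a , adm , top≢[] , _ , refl) =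
    (suc t , length-∷-digits 0 m (suc t * p)) ,
    (0<maxLen isS ∷ digits<maxLen η (suc t * p) adm , a 0 , δ*-digits η u (p' + t * p) adm) ,
    (λ (_ , e) → top≢[] (replicate⊑digits⇒segment≡[] m p (t * p) (_ , ∷-injectiveʳ e))) ,
    (λ { (_ , _ , _ , ()) })
  rep⇒rhs isS .(1 ∷ digits m (suc t * p)) (-[1+ suc _ ] , t , m , a , adm , top≢ , _ , refl) =
    (suc t , length-∷-digits 1 m (suc t * p)) ,
    (1<maxLen η isS ∷ digits<maxLen η (suc t * p) adm , a 0 , δ*-digits η u (p' + t * p) adm) ,
    (λ { (_ , ()) }) ,
    (λ (_ , isWmax , (_ , e)) → top≢ (TailRel-last⇒top-block≡ η p' (t * p) adm isWmax (_ , ∷-injectiveʳ e)))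

  ¬0Wmin⊑⇒top≢[] : ∀ t (m : ℕ → List (Fin k)) → ¬ ((0 ∷ Wmin p) ⊑ (0 ∷ digits m (suc t * p))) → segment m (t * p) p ≢ []
  ¬0Wmin⊑⇒top≢[] t m no0Wmin seg≡[] =
    no0Wmin (Product.map₂ (cong (0 ∷_)) (segment≡[]⇒replicate⊑digits m p (t * p) seg≡[]))

  rhs⇒rep₀ : FixedBy η p u → ∀ t ds {c} → length ds ≡ suc t * p → δ* η u (letter x₀) ds ≡ just (letter c) →
             ¬ ((0 ∷ Wmin p) ⊑ (0 ∷ ds)) → InRepImage η u p (0 ∷ ds)
  rhs⇒rep₀ fixed t ds len path no0Wmin with δ*⇒admissible η u (suc t * p) ds len path
  ... | m , a , adm , refl with m≤n⇒∃[o]m+o≡n (segment≢[]⇒0<length-expand η m p (t * p) (¬0Wmin⊑⇒top≢[] t m no0Wmin))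
  ... | r , 1+r≡|E| =
    ℤ.+ suc r , t , m , a , adm , ¬0Wmin⊑⇒top≢[] t m no0Wmin , (cong ℤ.+_ (sym 1+r≡|E|) , Reads.read reads-E) , refl
    where
    reads-E : Reads u (ℤ.+ 0) (expand η m (suc t * p))
    reads-E = Reads-⊑ (admissible⇒expand⊑ η (p' + t * p) adm) (fixed⇒Reads-iterW η {p} fixed (Reads-[ u ] (ℤ.+ 0)) (suc t))

  top-block≡⇒Wmax⊑ : ∀ t {m a} → Admissible η x₁ (suc t * p) m a →
                      expandFrom η m (t * p) p ++ a (t * p) ∷ [] ≡ iterW η p (x₁ ∷ []) →
                      ∃ λ W → IsWmax η u p W × (1 ∷ W) ⊑ (1 ∷ digits m (suc t * p))
  top-block≡⇒Wmax⊑ t {m} adm top≡ =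
    digits (m ∘ (t * p +_)) p , top-block≡⇒TailRel-last η p' (t * p) adm top≡ ,
    digits m (t * p) , cong (1 ∷_) (sym (digits-+ m p (t * p)))

  rhs⇒rep₁ : FixedBy η p u → ∀ t ds {c} → length ds ≡ suc t * p → δ* η u (letter x₁) ds ≡ just (letter c) →
             ¬ (∃ λ W → IsWmax η u p W × (1 ∷ W) ⊑ (1 ∷ ds)) → InRepImage η u p (1 ∷ ds)
  rhs⇒rep₁ fixed t ds len path no1Wmax with δ*⇒admissible η u (suc t * p) ds len path
  ... | m , a , adm , refl with m≤n⇒∃[o]m+o≡n (top-block≢⇒gap η p' (t * p) adm (no1Wmax ∘ top-block≡⇒Wmax⊑ t adm))
  ... | r , gap =
    -[1+ suc r ] , t , m , a , adm , no1Wmax ∘ top-block≡⇒Wmax⊑ t adm ,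
    (-L+i≡-[1+n] (trans (shuffle r _) gap) , Reads.read reads-E) , refl
    where
    shuffle : ∀ r e → suc (suc r + e) ≡ e + 2 + r
    shuffle = solve-∀
    reads-E : Reads u (ℤ.- ℤ.+ length (iterW η (suc t * p) (x₁ ∷ []))) (expand η m (suc t * p))
    reads-E = Reads-⊑ (admissible⇒expand⊑ η (p' + t * p) adm)
                (ReadsBack⇒Reads (fixed⇒ReadsBack-iterW η {p} fixed ReadsBack-[ u ] (suc t)))

  rhs⇒rep : FixedBy η p u → ∀ w → InRHS η u p w → InRepImage η u p w
  rhs⇒rep fixed []                ((ℓ , e) , _)            = ⊥-elim (0≢1+n (trans e (+-comm (ℓ * p) 1)))
  rhs⇒rep fixed (suc (suc _) ∷ _) (_ , (_ , _ , ()) , _)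
  rhs⇒rep fixed (0 ∷ [])          ((zero , _) , _)         = ℤ.+ 0 , refl
  rhs⇒rep fixed (1 ∷ [])          ((zero , _) , _)         = -[1+ 0 ] , refl
  rhs⇒rep fixed (_ ∷ _ ∷ _)       ((zero , ()) , _)
  rhs⇒rep fixed (0 ∷ ds) ((suc t , e) , (_ , _ , path) , no0Wmin , _) =
    rhs⇒rep₀ fixed t ds (suc-injective (trans e (+-comm _ 1))) path no0Wmin
  rhs⇒rep fixed (1 ∷ ds) ((suc t , e) , (_ , _ , path) , _ , no1Wmax) =
    rhs⇒rep₁ fixed t ds (suc-injective (trans e (+-comm _ 1))) path no1Wmax

lemma21 : ∀ {k : ℕ} (η : Subst k) (u : ℤ → Fin k) (p : ℕ) →
          IsSubstitution η →
          IsPeriodicPointWithPeriod η u p →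
          GrowingSeed η u →
          ∀ (w : List ℕ) → InRepImage η u p w ⇔ InRHS η u p w
lemma21 η u zero     _   (() , _)         _ _
lemma21 η u (suc p') isS (_ , fixed , _) _ w = mk⇔ (rep⇒rhs η u p' isS w) (rhs⇒rep η u p' fixed w)
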